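{- Let $S$ be a factorizable Boolean sublattice all of whose quarks have size at most $2$. The following are equivalent: (a) $S$ is a UFS; (b) for each connected component $C$ of the pairing graph $\mathcal{G}_p(S)$, the Boolean sublattice $\langle E(C)\rangle$ generated by the edges of $C$ (viewed as $2$-element subsets of $\mathbb{N}$) is a UFS; (c) each connected component of $\mathcal{G}_p(S)$ is a tree with diameter at most $3$.
   Context: Let $B_{\mathbb{N}}$ be the set of all finite subsets of $\mathbb{N}=\{1,2,3,\dots\}$, ordered by inclusion. A Boolean sublattice is a subset $S\subseteq B_{\mathbb{N}}$ containing $\emptyset$ and closed under finite unions. For a collection $T$ of finite subsets of $\mathbb{N}$, $\langle T\rangle$ denotes the smallest Boolean sublattice containing $T$. A quark of $S$ is a nonempty $A\in S$ such that no $B\in S$ satisfies $\emptyset\subsetneq B\subsetneq A$; $\mathcal{A}(S)$ is the set of quarks. $S$ is factorizable if every nonempty element of $S$ is a union of finitely many quarks. For nonempty $X\in S$, a factorization of $X$ in $S$ is a finite set $z\subseteq\mathcal{A}(S)$ with $\bigcup z=X$ and $\bigcup z'\subsetneq X$ for every proper subset $z'\subsetneq z$. $S$ is a UFS if every nonempty $X\in S$ has exactly one factorization. The pairing graph $\mathcal{G}_p(S)$ is the simple graph with vertex set $\mathbb{N}$ and an edge between distinct $a,b$ whenever $\{a,b\}\in\mathcal{A}(S)$ (graphs may be infinite; the diameter of a tree is the maximum length of a path in it). -}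

module Defs where

open import Level using (Level) renaming (suc to lsuc)
open import Data.Nat using (ℕ; _≤_)
open import Data.List using (List; []; _∷_; _++_; concat; length; [_])
open import Data.List.Membership.Propositional using (_∈_)
open import Data.List.Relation.Binary.Subset.Propositional using (_⊆_)
open import Data.List.Relation.Unary.All using (All)
open import Data.List.Relation.Unary.Any using (Any)
open import Data.List.Relation.Unary.Unique.Propositional using (Unique)
open import Data.List.Relation.Unary.Linked using (Linked)
open import Data.Product using (Σ; ∃; ∃₂; _×_; _,_)
open import Relation.Nullary using (¬_)
open import Relation.Binary.PropositionalEquality using (_≡_; _≢_)

private variable ℓ : Level

-- A finite subset of ℕ, represented by a list of its elements
-- (order and repetitions irrelevant; sets are compared extensionally).
FinSet : Set
FinSet = List ℕ

_≋_ : FinSet → FinSet → Set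
A ≋ B = (A ⊆ B) × (B ⊆ A)

_⊊_ : FinSet → FinSet → Set
A ⊊ B = (A ⊆ B) × ¬ (B ⊆ A)

NonEmpty : FinSet → Set
NonEmpty A = ∃ λ x → x ∈ A

record IsBooleanSublattice (S : FinSet → Set ℓ) : Set ℓ where
  field
    respects : ∀ {A B} → A ≋ B → S A → S B
    has-∅    : S []
    ∪-closed : ∀ {A B} → S A → S B → S (A ++ B)

Quark : (FinSet → Set ℓ) → FinSet → Set ℓ
Quark S A = S A × NonEmpty A × (∀ B → S B → NonEmpty B → ¬ (B ⊊ A))

Factorizable : (FinSet → Set ℓ) → Set ℓ
Factorizable S = ∀ X → S X → NonEmpty X →
  ∃ λ (z : List FinSet) → All (Quark S) z × (concat z ≋ X)

_∈ᶜ_ : FinSet → List FinSet → Set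
A ∈ᶜ z = Any (A ≋_) z

_⊆ᶜ_ : List FinSet → List FinSet → Set
z′ ⊆ᶜ z = All (_∈ᶜ z) z′

_⊊ᶜ_ : List FinSet → List FinSet → Set
z′ ⊊ᶜ z = (z′ ⊆ᶜ z) × ¬ (z ⊆ᶜ z′)

_≈ᶜ_ : List FinSet → List FinSet → Set
z′ ≈ᶜ z = (z′ ⊆ᶜ z) × (z ⊆ᶜ z′)

IsFactorization : (FinSet → Set ℓ) → FinSet → List FinSet → Set ℓ
IsFactorization S X z =
  All (Quark S) z × (concat z ≋ X) × (∀ z′ → z′ ⊊ᶜ z → concat z′ ⊊ X)

UFS : (FinSet → Set ℓ) → Set ℓ
UFS S = ∀ X → S X → NonEmpty X →
  ∃ λ z → IsFactorization S X z × (∀ z′ → IsFactorization S X z′ → z′ ≈ᶜ z)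

-- ⟨ T ⟩ : the smallest Boolean sublattice containing T
-- (intersection of all Boolean sublattices containing T)
Generated : (FinSet → Set ℓ) → FinSet → Set (lsuc ℓ)
Generated {ℓ} T X = ∀ (S′ : FinSet → Set ℓ) → IsBooleanSublattice S′ →
  (∀ A → T A → S′ A) → S′ X

-- Pairing graph G_p(S): vertex set ℕ, edge {a,b} iff a ≠ b and {a,b} is a quark
Adj : (FinSet → Set ℓ) → ℕ → ℕ → Set ℓ
Adj S a b = (a ≢ b) × Quark S (a ∷ b ∷ [])

data Reach (S : FinSet → Set ℓ) : ℕ → ℕ → Set ℓ where
  here : ∀ {a} → Reach S a a
  step : ∀ {a b c} → Adj S a b → Reach S b c → Reach S a c

-- the connected component of v is { u | Reach S v u };
-- its edges, as 2-element subsets of ℕ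
EdgesOf : (FinSet → Set ℓ) → ℕ → FinSet → Set ℓ
EdgesOf S v A = ∃₂ λ a b → Reach S v a × Adj S a b × (A ≡ a ∷ b ∷ [])

-- a path: a list of distinct vertices, consecutive ones adjacent;
-- its length is (number of vertices - 1)
IsPath : (FinSet → Set ℓ) → List ℕ → Set ℓ
IsPath S xs = Unique xs × Linked (Adj S) xs

IsCycle : (FinSet → Set ℓ) → List ℕ → Set ℓ
IsCycle S xs = ∃₂ λ u rest → (xs ≡ u ∷ rest) × (3 ≤ length xs) × Unique xs
  × Linked (Adj S) (xs ++ [ u ])

ComponentIsTree : (FinSet → Set ℓ) → ℕ → Set ℓ
ComponentIsTree S v =
  (∀ a b → Reach S v a → Reach S v b → Reach S a b) ×
  (∀ xs → All (Reach S v) xs → ¬ IsCycle S xs)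

-- every path in the component of v has length ≤ 3 (i.e. at most 4 vertices)
ComponentDiameter≤3 : (FinSet → Set ℓ) → ℕ → Set ℓ
ComponentDiameter≤3 S v = ∀ xs → All (Reach S v) xs → IsPath S xs → length xs ≤ 4

QuarksOfSize≤2 : (FinSet → Set ℓ) → Set ℓ
QuarksOfSize≤2 S = ∀ A → Quark S A → ∃ λ (L : FinSet) → (L ≋ A) × (length L ≤ 2)

-- A triangle, a 4-cycle or a path on five
-- vertices makes the union of its edges have two different factorizations, so a UFS avoids
-- all three. Conversely, each factor of a factorization owns a point lying in no other factor;
-- if a factor q of one factorization is missing from another, following that point and the
-- edges through it yields a non-backtracking walk of length 4, which a graph avoiding C₃, C₄
-- and P₅ cannot contain. Avoiding these configurations means exactly that every component is a
-- tree of diameter ≤ 3, and it can be checked one component at a time, because the quarks of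
-- ⟨E(C)⟩ are precisely the edges of C.

module Submission where

open import Defs
open import Level using (Level)
open import Data.Nat using (ℕ; _≤_; s≤s; z≤n; _≟_)
open import Data.Nat.Properties using (n≮n)
open import Data.Product using (∃; _×_; _,_; proj₁; proj₂)
open import Data.Sum using (_⊎_; inj₁; inj₂; fromInj₂)
open import Data.Empty using (⊥; ⊥-elim)
open import Function using (_∘_)
open import Data.List using (List; []; _∷_; _++_; concat; length; [_]; filter)
open import Data.List.Properties using (++-identityʳ; concat-++)
open import Data.List.Membership.Propositional using (_∈_; _∉_; find; lose)
open import Data.List.Membership.DecPropositional _≟_ using (_∈?_)
open import Data.List.Membership.Propositional.Properties
  using (∈-concat⁺′; ∈-concat⁻′; ∈-filter⁺; ∈-filter⁻; ∈-++⁺ˡ; ∈-++⁺ʳ; ∈-++⁻)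
open import Data.List.Relation.Binary.Subset.Propositional using (_⊆_)
open import Data.List.Relation.Binary.Subset.Propositional.Properties
  using (⊆-trans; ⊆-reflexive-↭) renaming (++⁺ to ++⁺-⊆)
open import Data.List.Relation.Binary.Permutation.Propositional using (↭-trans; ↭-sym)
open import Data.List.Relation.Binary.Permutation.Propositional.Properties
  using (shifts) renaming (++-assoc to ↭-++-assoc)
open import Data.List.Relation.Unary.All as All using (All; []; _∷_)
open import Data.List.Relation.Unary.All.Properties using (¬All⇒Any¬; All¬⇒¬Any) renaming (++⁺ to All-++⁺)
open import Data.List.Relation.Unary.Any as Any using (here; there; any?)
open import Data.List.Relation.Unary.AllPairs using ([]; _∷_)
open import Data.List.Relation.Unary.Linked using ([]; [-]; _∷_)
open import Relation.Nullary using (¬_; Dec; yes; no; ¬?; contradiction)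
open import Relation.Nullary.Decidable using (map′; _×-dec_; decidable-stable)
open import Relation.Binary.PropositionalEquality using (_≡_; _≢_; refl; sym; subst; ≢-sym)

private variable
  ℓ ℓ′ : Level
  a b c d e x y : ℕ
  A B C D X q r : FinSet
  z z₁ z₂ : List FinSet

pattern #0 = here refl
pattern #1 = there #0
pattern #2 = there #1
pattern #3 = there #2
pattern #4 = there #3
pattern #5 = there #4

≋-refl : A ≋ A
≋-refl = (λ m → m) , (λ m → m)

≋-reflexive : A ≡ B → A ≋ B
≋-reflexive refl = ≋-refl

≋-sym : A ≋ B → B ≋ A
≋-sym (f , g) = g , f

≋-trans : A ≋ B → B ≋ C → A ≋ C
≋-trans (f , g) (h , k) = h ∘ f , g ∘ k

++⁺-≋ : A ≋ B → C ≋ D → (A ++ C) ≋ (B ++ D)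
++⁺-≋ (A⊆B , B⊆A) (C⊆D , D⊆C) = ++⁺-⊆ A⊆B C⊆D , ++⁺-⊆ B⊆A D⊆C

pair-comm : (a ∷ b ∷ []) ≋ (b ∷ a ∷ [])
pair-comm = swap , swap
  where
  swap : ∀ {a b} → (a ∷ b ∷ []) ⊆ (b ∷ a ∷ [])
  swap #0 = #1
  swap #1 = #0

pair-diag : (a ∷ a ∷ []) ≋ [ a ]
pair-diag = (λ { #0 → #0 ; #1 → #0 }) , (λ { #0 → #0 })

short-list-shape : ∀ R → length R ≤ 2 → x ∈ R → R ≋ [ x ] ⊎ ∃ λ y → x ≢ y × R ≋ (x ∷ y ∷ [])
short-list-shape (_ ∷ []) _ #0 = inj₁ ≋-refl
short-list-shape {x} (_ ∷ y ∷ []) _ #0 with x ≟ y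
... | yes refl = inj₁ pair-diag
... | no x≢y = inj₂ (y , x≢y , ≋-refl)
short-list-shape {x} (w ∷ _ ∷ []) _ #1 with x ≟ w
... | yes refl = inj₁ pair-diag
... | no x≢w = inj₂ (w , x≢w , pair-comm)
short-list-shape (_ ∷ _ ∷ _ ∷ _) (s≤s (s≤s ())) _

∉-pair : x ≢ a → x ≢ b → x ∉ (a ∷ b ∷ [])
∉-pair x≢a x≢b #0 = x≢a refl
∉-pair x≢a x≢b #1 = x≢b refl

∈∉⇒≉ : x ∈ A → x ∉ B → ¬ (A ≋ B)
∈∉⇒≉ x∈A x∉B A≋B = x∉B (proj₁ A≋B x∈A)

partners-differ : A ≋ (x ∷ a ∷ []) → B ≋ (x ∷ b ∷ []) → ¬ (A ≋ B) → a ≢ b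
partners-differ A≋xa B≋xb A≉B refl = A≉B (≋-trans A≋xa (≋-sym B≋xb))

_⊆?_ : (A B : FinSet) → Dec (A ⊆ B)
A ⊆? B = map′ All.lookup All.tabulate (All.all? (_∈? B) A)

_≋?_ : (A B : FinSet) → Dec (A ≋ B)
A ≋? B = (A ⊆? B) ×-dec (B ⊆? A)

_≉?_ : (A B : FinSet) → Dec (¬ (A ≋ B))
A ≉? B = ¬? (A ≋? B)

⊈⇒∃∉ : ¬ (A ⊆ B) → ∃ λ x → x ∈ A × x ∉ B
⊈⇒∃∉ {A} {B} A⊈B = find (¬All⇒Any¬ (_∈? B) A (A⊈B ∘ All.lookup))

⊆-by : All (_∈ B) A → A ⊆ B
⊆-by = All.lookup

member⊆concat : A ∈ z → A ⊆ concat z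
member⊆concat A∈z x∈A = ∈-concat⁺′ x∈A A∈z

concat⊆ : All (_⊆ X) z → concat z ⊆ X
concat⊆ {z = z} z⊆X x∈z with ∈-concat⁻′ z x∈z
... | _ , x∈w , w∈z = All.lookup z⊆X w∈z x∈w

⊆ᶜ-trans : z ⊆ᶜ z₁ → z₁ ⊆ᶜ z₂ → z ⊆ᶜ z₂
⊆ᶜ-trans z⊆z₁ z₁⊆z₂ = All.map (λ A∈z₁ → let _ , w∈z₁ , A≋w = find A∈z₁
                                        in Any.map (≋-trans A≋w) (All.lookup z₁⊆z₂ w∈z₁))
                              z⊆z₁

module _ {L : FinSet → Set ℓ} where

  quark-respects : (∀ {A B} → A ≋ B → L A → L B) → Quark L A → A ≋ B → Quark L B
  quark-respects resp (LA , (x , x∈A) , minimal) A≋B =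
    resp A≋B LA , (x , proj₁ A≋B x∈A) ,
    λ C LC C≠∅ (C⊆B , B⊈C) → minimal C LC C≠∅ (proj₂ A≋B ∘ C⊆B , λ A⊆C → B⊈C (A⊆C ∘ proj₂ A≋B))

  quark-⊆-quark : Quark L q → Quark L r → r ⊆ q → r ≋ q
  quark-⊆-quark {q} {r} (_ , _ , minimal) (Lr , r≠∅ , _) r⊆q =
    r⊆q , decidable-stable (q ⊆? r) (λ q⊈r → minimal r Lr r≠∅ (r⊆q , q⊈r))

  quark-shape : QuarksOfSize≤2 L → Quark L r → x ∈ r → r ≋ [ x ] ⊎ ∃ λ y → x ≢ y × r ≋ (x ∷ y ∷ [])
  quark-shape {r} qs Qr x∈r with qs r Qr
  ... | R , R≋r , |R|≤2 with short-list-shape R |R|≤2 (proj₂ R≋r x∈r)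
  ... | inj₁ R≋x = inj₁ (≋-trans (≋-sym R≋r) R≋x)
  ... | inj₂ (y , x≢y , R≋xy) = inj₂ (y , x≢y , ≋-trans (≋-sym R≋r) R≋xy)

  meeting-quark-is-edge : QuarksOfSize≤2 L → Quark L q → Quark L r → ¬ (r ≋ q) → x ∈ q → x ∈ r →
    ∃ λ y → x ≢ y × r ≋ (x ∷ y ∷ [])
  meeting-quark-is-edge qs Qq Qr r≉q x∈q x∈r with quark-shape qs Qr x∈r
  ... | inj₂ edge = edge
  ... | inj₁ r≋x = contradiction (quark-⊆-quark Qq Qr (⊆-trans (proj₁ r≋x) (⊆-by (x∈q ∷ [])))) r≉q

IsPrivatePoint : List FinSet → FinSet → ℕ → Set
IsPrivatePoint z q p = p ∈ q × All (λ w → w ≋ q ⊎ p ∉ w) z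

HasPrivatePoints : List FinSet → Set
HasPrivatePoints z = All (λ q → ∃ (IsPrivatePoint z q)) z

private-points⇒irredundant : All (_⊆ X) z → HasPrivatePoints z → ∀ z′ → z′ ⊊ᶜ z → concat z′ ⊊ X
private-points⇒irredundant {X} {z} z⊆X points z′ (z′⊆z , z⊈z′) =
  concat⊆ (All.map member⊆X z′⊆z) , λ X⊆z′ → z⊈z′ (All.tabulate (λ q∈z → q∈ᶜz′ q∈z X⊆z′))
  where
  member⊆X : A ∈ᶜ z → A ⊆ X
  member⊆X A∈z with find A∈z
  ... | _ , w∈z , A≋w = ⊆-trans (proj₁ A≋w) (All.lookup z⊆X w∈z)

  q∈ᶜz′ : q ∈ z → X ⊆ concat z′ → q ∈ᶜ z′
  q∈ᶜz′ q∈z X⊆z′ with All.lookup points q∈z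
  ... | p , p∈q , alone with ∈-concat⁻′ z′ (X⊆z′ (All.lookup z⊆X q∈z p∈q))
  ... | w′ , p∈w′ , w′∈z′ with find (All.lookup z′⊆z w′∈z′)
  ... | w , w∈z , w′≋w with All.lookup alone w∈z
  ... | inj₁ w≋q = lose w′∈z′ (≋-sym (≋-trans w′≋w w≋q))
  ... | inj₂ p∉w = contradiction (proj₁ w′≋w p∈w′) p∉w

-- Greedy pruning: keep a member only if the remaining ones fail to cover X;
-- a point witnessing that failure is then private to it.
module _ {P : FinSet → Set ℓ} (X : FinSet) where

  private
    Invariant : List FinSet → List FinSet → Set
    Invariant kept rest = All (λ q → ∃ λ p → p ∉ concat rest × IsPrivatePoint kept q p) kept

    prune : ∀ kept rest → All P kept → All P rest → X ⊆ concat kept ++ concat rest → Invariant kept rest →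
      ∃ λ z → All P z × X ⊆ concat z × HasPrivatePoints z
    prune kept [] Pkept _ cover inv =
      kept , Pkept , subst (_ ∈_) (++-identityʳ (concat kept)) ∘ cover ,
      All.map (λ (p , _ , isPrivate) → p , isPrivate) inv
    prune kept (q ∷ rest) Pkept (Pq ∷ Prest) cover inv with X ⊆? (concat kept ++ concat rest)
    ... | yes cover′ = prune kept rest Pkept Prest cover′
            (All.map (λ (p , p∉ , isPrivate) → p , p∉ ∘ ∈-++⁺ʳ q , isPrivate) inv)
    ... | no ¬cover′ with ⊈⇒∃∉ ¬cover′
    ... | p , p∈X , p∉ = prune (q ∷ kept) rest (Pq ∷ Pkept) Prest cover″ (new ∷ All.map old inv)
      where
      cover″ : X ⊆ concat (q ∷ kept) ++ concat rest
      cover″ = ⊆-reflexive-↭ (↭-trans (shifts (concat kept) q) (↭-sym (↭-++-assoc q (concat kept) (concat rest))))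
             ∘ cover

      p∈q : p ∈ q
      p∈q with ∈-++⁻ (concat kept) (cover p∈X)
      ... | inj₁ p∈kept = contradiction (∈-++⁺ˡ p∈kept) p∉
      ... | inj₂ p∈q++rest with ∈-++⁻ q p∈q++rest
      ...   | inj₁ p∈q = p∈q
      ...   | inj₂ p∈rest = contradiction (∈-++⁺ʳ (concat kept) p∈rest) p∉

      new : ∃ λ p → p ∉ concat rest × IsPrivatePoint (q ∷ kept) q p
      new = p , p∉ ∘ ∈-++⁺ʳ (concat kept) , p∈q ,
            inj₁ ≋-refl ∷ All.tabulate (λ w∈kept → inj₂ (p∉ ∘ ∈-++⁺ˡ ∘ λ p∈w → ∈-concat⁺′ p∈w w∈kept))

      old : ∀ {w} → (∃ λ p → p ∉ concat (q ∷ rest) × IsPrivatePoint kept w p) →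
                    ∃ λ p → p ∉ concat rest × IsPrivatePoint (q ∷ kept) w p
      old (p , p∉ , p∈w , alone) = p , p∉ ∘ ∈-++⁺ʳ q , p∈w , inj₂ (p∉ ∘ ∈-++⁺ˡ) ∷ alone

  irredundant-subcover : ∀ z → All P z → X ⊆ concat z → ∃ λ z′ → All P z′ × X ⊆ concat z′ × HasPrivatePoints z′
  irredundant-subcover z Pz cover = prune [] z [] Pz cover []

module _ {L : FinSet → Set ℓ} where

  private-points⇒factorization : All (Quark L) z → concat z ≋ X → HasPrivatePoints z → IsFactorization L X z
  private-points⇒factorization Qz z≋X points =
    Qz , z≋X , private-points⇒irredundant (All.tabulate (λ w∈z → ⊆-trans (member⊆concat w∈z) (proj₁ z≋X))) points

  factorization-exists : All (Quark L) z → concat z ≋ X → ∃ (IsFactorization L X)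
  factorization-exists {z} {X} Qz (z⊆X , X⊆z)
    with irredundant-subcover {P = λ w → Quark L w × w ⊆ X} X z
           (All.tabulate (λ w∈z → All.lookup Qz w∈z , ⊆-trans (member⊆concat w∈z) z⊆X)) X⊆z
  ... | z′ , Q⊆X , X⊆z′ , points =
    z′ , private-points⇒factorization (All.map proj₁ Q⊆X) (concat⊆ (All.map proj₂ Q⊆X) , X⊆z′) points

  factor-has-private-point : IsFactorization L X z → q ∈ z → ∃ (IsPrivatePoint z q)
  factor-has-private-point {X} {z} {q} (_ , z≋X , irredundant) q∈z
    with ⊈⇒∃∉ (proj₂ (irredundant others others⊊z))
    where
    others = filter (_≉? q) z
    others⊊z : others ⊊ᶜ z
    others⊊z = All.tabulate (λ w∈others → lose (proj₁ (∈-filter⁻ (_≉? q) {xs = z} w∈others)) ≋-refl)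
             , λ z⊆others → let _ , w∈others , q≋w = find (All.lookup z⊆others q∈z)
                            in proj₂ (∈-filter⁻ (_≉? q) {xs = z} w∈others) (≋-sym q≋w)
  ... | x , x∈X , x∉others = x , x∈q , alone
    where
    alone : All (λ w → w ≋ q ⊎ x ∉ w) z
    alone = All.tabulate λ {w} w∈z → classify (w ≋? q) w∈z
      where
      classify : ∀ {w} → Dec (w ≋ q) → w ∈ z → w ≋ q ⊎ x ∉ w
      classify (yes w≋q) _ = inj₁ w≋q
      classify (no w≉q) w∈z = inj₂ (x∉others ∘ λ x∈w → ∈-concat⁺′ x∈w (∈-filter⁺ (_≉? q) w∈z w≉q))

    x∈q : x ∈ q
    x∈q with ∈-concat⁻′ z (proj₂ z≋X x∈X)
    ... | w , x∈w , w∈z with All.lookup alone w∈z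
    ...   | inj₁ w≋q = proj₁ w≋q x∈w
    ...   | inj₂ x∉w = contradiction x∈w x∉w

record AvoidsC₃C₄P₅ (L : FinSet → Set ℓ) : Set ℓ where
  field
    no-C₃ : Adj L a b → Adj L b c → Adj L c a → ⊥
    no-C₄ : Adj L a b → Adj L b c → Adj L c d → Adj L d a → a ≢ c → b ≢ d → ⊥
    no-P₅ : Adj L a b → Adj L b c → Adj L c d → Adj L d e →
            a ≢ c → a ≢ d → a ≢ e → b ≢ d → b ≢ e → c ≢ e → ⊥

  no-nonbacktracking-walk₄ : Adj L a b → Adj L b c → Adj L c d → Adj L d e → a ≢ c → b ≢ d → c ≢ e → ⊥
  no-nonbacktracking-walk₄ {a} {b} {c} {d} {e} ab bc cd de a≢c b≢d c≢e with a ≟ d | b ≟ e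
  ... | yes refl | _ = no-C₃ ab bc cd
  ... | no _ | yes refl = no-C₃ bc cd de
  ... | no a≢d | no b≢e with a ≟ e
  ...   | yes refl = no-C₄ ab bc cd de a≢c b≢d
  ...   | no a≢e = no-P₅ ab bc cd de a≢c a≢d a≢e b≢d b≢e c≢e

avoids-⊆ : {L : FinSet → Set ℓ} {L′ : FinSet → Set ℓ′} →
  (∀ {a b} → Adj L′ a b → Adj L a b) → AvoidsC₃C₄P₅ L → AvoidsC₃C₄P₅ L′
avoids-⊆ f avoids = record
  { no-C₃ = λ ab bc ca → no-C₃ (f ab) (f bc) (f ca)
  ; no-C₄ = λ ab bc cd da → no-C₄ (f ab) (f bc) (f cd) (f da)
  ; no-P₅ = λ ab bc cd de → no-P₅ (f ab) (f bc) (f cd) (f de)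
  }
  where open AvoidsC₃C₄P₅ avoids

module _ {L : FinSet → Set ℓ} (respects : ∀ {A B} → A ≋ B → L A → L B) where

  edge⇒adj : Quark L r → r ≋ (a ∷ b ∷ []) → a ≢ b → Adj L a b
  edge⇒adj Qr r≋ab a≢b = a≢b , quark-respects respects Qr r≋ab

  adj-sym : Adj L a b → Adj L b a
  adj-sym (a≢b , Qab) = edge⇒adj Qab pair-comm (≢-sym a≢b)

  -- If q ∈ z₁ were missing from z₂, a point x private to q, the neighbour b of x in q, the
  -- neighbours c and d of x and b in z₂, and a neighbour e of c in z₁ would form the walk e c x b d.
  factor-shared : QuarksOfSize≤2 L → AvoidsC₃C₄P₅ L →
    IsFactorization L X z₁ → IsFactorization L X z₂ → q ∈ z₁ → q ∈ᶜ z₂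
  factor-shared {X} {z₁} {z₂} {q} qs avoids F₁@(Q₁ , z₁≋X , _) (Q₂ , z₂≋X , _) q∈z₁ with any? (q ≋?_) z₂
  ... | yes q∈z₂ = q∈z₂
  ... | no q∉z₂ =
    let x , x∈q , alone = factor-has-private-point F₁ q∈z₁
        r₂ , x∈r₂ , r₂∈z₂ = ∈-concat⁻′ z₂ (proj₂ z₂≋X (q⊆X x∈q))
        Qq = All.lookup Q₁ q∈z₁
        Qr₂ = All.lookup Q₂ r₂∈z₂
        c , x≢c , r₂≋xc = meeting-quark-is-edge qs Qq Qr₂ (≉q r₂∈z₂) x∈q x∈r₂
        b , x≢b , q≋xb = meeting-quark-is-edge qs Qr₂ Qq (≉q r₂∈z₂ ∘ ≋-sym) x∈r₂ x∈q
        b∈q = proj₂ q≋xb #1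
        r₃ , b∈r₃ , r₃∈z₂ = ∈-concat⁻′ z₂ (proj₂ z₂≋X (q⊆X b∈q))
        Qr₃ = All.lookup Q₂ r₃∈z₂
        d , b≢d , r₃≋bd = meeting-quark-is-edge qs Qq Qr₃ (≉q r₃∈z₂) b∈q b∈r₃
        c∈r₂ = proj₂ r₂≋xc #1
        w , c∈w , w∈z₁ = ∈-concat⁻′ z₁ (proj₂ z₁≋X (proj₁ z₂≋X (member⊆concat r₂∈z₂ c∈r₂)))
        Qw = All.lookup Q₁ w∈z₁
        c≢b = partners-differ r₂≋xc q≋xb (≉q r₂∈z₂)
        d≢x = partners-differ r₃≋bd (≋-trans q≋xb pair-comm) (≉q r₃∈z₂)
        x∉w : x ∉ w
        x∉w = fromInj₂ (λ w≋q → ⊥-elim (∉-pair (≢-sym x≢c) c≢b (proj₁ q≋xb (proj₁ w≋q c∈w))))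
                       (All.lookup alone w∈z₁)
        e , c≢e , w≋ce = meeting-quark-is-edge qs Qr₂ Qw (∈∉⇒≉ (proj₂ r₂≋xc #0) x∉w ∘ ≋-sym) c∈r₂ c∈w
        x≢e = x∉w ∘ proj₂ w≋ce ∘ there ∘ here
    in ⊥-elim (no-nonbacktracking-walk₄
         (adj-sym (edge⇒adj Qw w≋ce c≢e)) (adj-sym (edge⇒adj Qr₂ r₂≋xc x≢c))
         (edge⇒adj Qq q≋xb x≢b) (edge⇒adj Qr₃ r₃≋bd b≢d)
         (≢-sym x≢e) c≢b (≢-sym d≢x))
    where
    open AvoidsC₃C₄P₅ avoids
    q⊆X : q ⊆ X
    q⊆X = ⊆-trans (member⊆concat q∈z₁) (proj₁ z₁≋X)
    ≉q : r ∈ z₂ → ¬ (r ≋ q)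
    ≉q r∈z₂ r≋q = q∉z₂ (lose r∈z₂ (≋-sym r≋q))

avoids⇒ufs : {L : FinSet → Set ℓ} → IsBooleanSublattice L → Factorizable L → QuarksOfSize≤2 L →
  AvoidsC₃C₄P₅ L → UFS L
avoids⇒ufs bsl factorizable qs avoids X LX X≠∅ with factorizable X LX X≠∅
... | z₀ , Qz₀ , z₀≋X with factorization-exists Qz₀ z₀≋X
... | z , F = z , F , λ z′ F′ → All.tabulate (shared F′ F) , All.tabulate (shared F F′)
  where
  shared : IsFactorization _ X z₁ → IsFactorization _ X z₂ → q ∈ z₁ → q ∈ᶜ z₂
  shared = factor-shared (IsBooleanSublattice.respects bsl) qs avoids

concat-closed : {L : FinSet → Set ℓ} → IsBooleanSublattice L → All L z → L (concat z)
concat-closed bsl [] = IsBooleanSublattice.has-∅ bsl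
concat-closed bsl (Lw ∷ Lz) = IsBooleanSublattice.∪-closed bsl Lw (concat-closed bsl Lz)

module _ {L : FinSet → Set ℓ} (bsl : IsBooleanSublattice L) (ufs : UFS L) where

  private
    covers-with-private-points-agree : All (Quark L) z₁ → All (Quark L) z₂ → concat z₂ ≋ concat z₁ →
      HasPrivatePoints z₁ → HasPrivatePoints z₂ → q ∈ z₁ → q ∈ᶜ z₂
    covers-with-private-points-agree {z₁} {z₂} Q₁ Q₂ z₂≋z₁ points₁ points₂ q∈z₁
      with All.lookup points₁ q∈z₁
    ... | p , p∈q , _ with ufs (concat z₁) (concat-closed bsl (All.map proj₁ Q₁)) (p , member⊆concat q∈z₁ p∈q)
    ... | _ , _ , unique =
      All.lookup (⊆ᶜ-trans (proj₁ (unique z₁ (private-points⇒factorization Q₁ ≋-refl points₁)))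
                           (proj₂ (unique z₂ (private-points⇒factorization Q₂ z₂≋z₁ points₂))))
                 q∈z₁

  ufs⇒avoids : AvoidsC₃C₄P₅ L
  ufs⇒avoids = record { no-C₃ = no-C₃ ; no-C₄ = no-C₄ ; no-P₅ = no-P₅ }
    where
    -- {ab, bc} and {ab, ca} both factorize {a, b, c}.
    no-C₃ : Adj L a b → Adj L b c → Adj L c a → ⊥
    no-C₃ {a} {b} {c} (a≢b , Qab) (b≢c , Qbc) (c≢a , Qca) =
      All¬⇒¬Any (∈∉⇒≉ #1 (∉-pair c≢a (≢-sym b≢c)) ∷ ∈∉⇒≉ #0 (∉-pair b≢c (≢-sym a≢b)) ∷ [])
        (covers-with-private-points-agree (Qab ∷ Qbc ∷ []) (Qab ∷ Qca ∷ [])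
          (⊆-by (#0 ∷ #1 ∷ #3 ∷ #0 ∷ []) , ⊆-by (#0 ∷ #1 ∷ #1 ∷ #2 ∷ []))
          ((a , #0 , inj₁ ≋-refl ∷ inj₂ (∉-pair a≢b (≢-sym c≢a)) ∷ []) ∷
           (c , #1 , inj₂ (∉-pair c≢a (≢-sym b≢c)) ∷ inj₁ ≋-refl ∷ []) ∷ [])
          ((b , #1 , inj₁ ≋-refl ∷ inj₂ (∉-pair b≢c (≢-sym a≢b)) ∷ []) ∷
           (c , #0 , inj₂ (∉-pair c≢a (≢-sym b≢c)) ∷ inj₁ ≋-refl ∷ []) ∷ [])
          #1)

    -- {ab, cd} and {bc, da} both factorize {a, b, c, d}.
    no-C₄ : Adj L a b → Adj L b c → Adj L c d → Adj L d a → a ≢ c → b ≢ d → ⊥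
    no-C₄ {a} {b} {c} {d} (a≢b , Qab) (b≢c , Qbc) (c≢d , Qcd) (d≢a , Qda) a≢c b≢d =
      All¬⇒¬Any (∈∉⇒≉ #0 (∉-pair a≢b a≢c) ∷ ∈∉⇒≉ #1 (∉-pair b≢d (≢-sym a≢b)) ∷ [])
        (covers-with-private-points-agree (Qab ∷ Qcd ∷ []) (Qbc ∷ Qda ∷ [])
          (⊆-by (#1 ∷ #2 ∷ #3 ∷ #0 ∷ []) , ⊆-by (#3 ∷ #0 ∷ #1 ∷ #2 ∷ []))
          ((a , #0 , inj₁ ≋-refl ∷ inj₂ (∉-pair a≢c (≢-sym d≢a)) ∷ []) ∷
           (c , #0 , inj₂ (∉-pair (≢-sym a≢c) (≢-sym b≢c)) ∷ inj₁ ≋-refl ∷ []) ∷ [])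
          ((b , #0 , inj₁ ≋-refl ∷ inj₂ (∉-pair b≢d (≢-sym a≢b)) ∷ []) ∷
           (d , #0 , inj₂ (∉-pair (≢-sym b≢d) (≢-sym c≢d)) ∷ inj₁ ≋-refl ∷ []) ∷ [])
          #0)

    -- {ab, cd, de} and {ab, bc, de} both factorize {a, b, c, d, e}.
    no-P₅ : Adj L a b → Adj L b c → Adj L c d → Adj L d e →
            a ≢ c → a ≢ d → a ≢ e → b ≢ d → b ≢ e → c ≢ e → ⊥
    no-P₅ {a} {b} {c} {d} {e} (a≢b , Qab) (b≢c , Qbc) (c≢d , Qcd) (d≢e , Qde) a≢c a≢d a≢e b≢d b≢e c≢e =
      All¬⇒¬Any (∈∉⇒≉ #0 (∉-pair (≢-sym a≢c) (≢-sym b≢c)) ∷ ∈∉⇒≉ #1 (∉-pair (≢-sym b≢d) (≢-sym c≢d))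
                 ∷ ∈∉⇒≉ #0 (∉-pair c≢d c≢e) ∷ [])
        (covers-with-private-points-agree (Qab ∷ Qcd ∷ Qde ∷ []) (Qab ∷ Qbc ∷ Qde ∷ [])
          (⊆-by (#0 ∷ #1 ∷ #1 ∷ #2 ∷ #3 ∷ #5 ∷ []) , ⊆-by (#0 ∷ #1 ∷ #3 ∷ #4 ∷ #4 ∷ #5 ∷ []))
          ((a , #0 , inj₁ ≋-refl ∷ inj₂ (∉-pair a≢c a≢d) ∷ inj₂ (∉-pair a≢d a≢e) ∷ []) ∷
           (c , #0 , inj₂ (∉-pair (≢-sym a≢c) (≢-sym b≢c)) ∷ inj₁ ≋-refl ∷ inj₂ (∉-pair c≢d c≢e) ∷ []) ∷
           (e , #1 , inj₂ (∉-pair (≢-sym a≢e) (≢-sym b≢e)) ∷ inj₂ (∉-pair (≢-sym c≢e) (≢-sym d≢e))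
                   ∷ inj₁ ≋-refl ∷ []) ∷ [])
          ((a , #0 , inj₁ ≋-refl ∷ inj₂ (∉-pair a≢b a≢c) ∷ inj₂ (∉-pair a≢d a≢e) ∷ []) ∷
           (c , #1 , inj₂ (∉-pair (≢-sym a≢c) (≢-sym b≢c)) ∷ inj₁ ≋-refl ∷ inj₂ (∉-pair c≢d c≢e) ∷ []) ∷
           (e , #1 , inj₂ (∉-pair (≢-sym a≢e) (≢-sym b≢e)) ∷ inj₂ (∉-pair (≢-sym b≢e) (≢-sym c≢e))
                   ∷ inj₁ ≋-refl ∷ []) ∷ [])
          #1)

generated-isBooleanSublattice : {T : FinSet → Set ℓ} → IsBooleanSublattice (Generated T)
generated-isBooleanSublattice = record
  { respects = λ A≋B TA S′ bsl T⊆S′ → IsBooleanSublattice.respects bsl A≋B (TA S′ bsl T⊆S′)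
  ; has-∅ = λ S′ bsl _ → IsBooleanSublattice.has-∅ bsl
  ; ∪-closed = λ TA TB S′ bsl T⊆S′ → IsBooleanSublattice.∪-closed bsl (TA S′ bsl T⊆S′) (TB S′ bsl T⊆S′)
  }

module Component (S : FinSet → Set) (bsl : IsBooleanSublattice S) (v : ℕ) where

  ⟨C⟩ : FinSet → Set₁
  ⟨C⟩ = Generated (EdgesOf S v)

  UnionOfEdges : FinSet → Set
  UnionOfEdges X = ∃ λ es → All (EdgesOf S v) es × concat es ≋ X

  unionsOfEdges-isBooleanSublattice : IsBooleanSublattice UnionOfEdges
  unionsOfEdges-isBooleanSublattice = record
    { respects = λ { A≋B (es , E , es≋A) → es , E , ≋-trans es≋A A≋B }
    ; has-∅ = [] , [] , ≋-refl
    ; ∪-closed = λ { (es , E , es≋A) (fs , F , fs≋B) →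
        es ++ fs , All-++⁺ E F ,
        ≋-trans (≋-reflexive (sym (concat-++ es fs))) (++⁺-≋ es≋A fs≋B) }
    }

  generated⇒unionOfEdges : ⟨C⟩ X → UnionOfEdges X
  generated⇒unionOfEdges ⟨C⟩X = ⟨C⟩X UnionOfEdges unionsOfEdges-isBooleanSublattice
    λ A E → [ A ] , E ∷ [] , ≋-reflexive (++-identityʳ A)

  generated⇒S : ⟨C⟩ X → S X
  generated⇒S ⟨C⟩X = ⟨C⟩X S bsl λ { A (_ , _ , _ , (_ , QA) , refl) → proj₁ QA }

  edge⇒quark : EdgesOf S v A → Quark ⟨C⟩ A
  edge⇒quark E@(a , _ , _ , (_ , (_ , _ , minimal)) , refl) =
    (λ _ _ E⊆S′ → E⊆S′ _ E) , (a , #0) , λ B ⟨C⟩B → minimal B (generated⇒S ⟨C⟩B)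

  quark⇒edge : Quark ⟨C⟩ q → ∃ λ E → EdgesOf S v E × q ≋ E
  quark⇒edge Qq@(⟨C⟩q , (x , x∈q) , _) with generated⇒unionOfEdges ⟨C⟩q
  ... | es , Es , es≋q with ∈-concat⁻′ es (proj₂ es≋q x∈q)
  ... | E , x∈E , E∈es = E , edge , ≋-sym (quark-⊆-quark Qq (edge⇒quark edge) E⊆q)
    where
    edge = All.lookup Es E∈es
    E⊆q = ⊆-trans (member⊆concat E∈es) (proj₁ es≋q)

  generated-quarks≤2 : QuarksOfSize≤2 ⟨C⟩
  generated-quarks≤2 q Qq with quark⇒edge Qq
  ... | _ , (a , b , _ , _ , refl) , q≋ab = a ∷ b ∷ [] , ≋-sym q≋ab , s≤s (s≤s z≤n)

  generated-factorizable : Factorizable ⟨C⟩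
  generated-factorizable X ⟨C⟩X _ with generated⇒unionOfEdges ⟨C⟩X
  ... | es , Es , es≋X = es , All.map edge⇒quark Es , es≋X

  generated-adj⇒adj : Adj ⟨C⟩ a b → Adj S a b
  generated-adj⇒adj (a≢b , Qab) with quark⇒edge Qab
  ... | _ , (_ , _ , _ , (_ , Q) , refl) , ab≋E =
    a≢b , quark-respects (IsBooleanSublattice.respects bsl) Q (≋-sym ab≋E)

  adj⇒generated-adj : Reach S v a → Adj S a b → Adj ⟨C⟩ a b
  adj⇒generated-adj v⇝a ab = proj₁ ab , edge⇒quark (_ , _ , v⇝a , ab , refl)

module _ (S : FinSet → Set) (bsl : IsBooleanSublattice S) where
  open Component S bsl

  avoids⇒component-avoids : AvoidsC₃C₄P₅ S → ∀ v → AvoidsC₃C₄P₅ (⟨C⟩ v)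
  avoids⇒component-avoids avoids v = avoids-⊆ (generated-adj⇒adj v) avoids

  -- Each forbidden configuration lies in the component of its first vertex.
  components-avoid⇒avoids : (∀ v → AvoidsC₃C₄P₅ (⟨C⟩ v)) → AvoidsC₃C₄P₅ S
  components-avoid⇒avoids avoids = record
    { no-C₃ = λ {a} ab bc ca → let open AvoidsC₃C₄P₅ (avoids a); ↑ = adj⇒generated-adj a in
        no-C₃ (↑ here ab) (↑ (step ab here) bc) (↑ (step ab (step bc here)) ca)
    ; no-C₄ = λ {a} ab bc cd da → let open AvoidsC₃C₄P₅ (avoids a); ↑ = adj⇒generated-adj a in
        no-C₄ (↑ here ab) (↑ (step ab here) bc) (↑ (step ab (step bc here)) cd)
              (↑ (step ab (step bc (step cd here))) da)
    ; no-P₅ = λ {a} ab bc cd de → let open AvoidsC₃C₄P₅ (avoids a); ↑ = adj⇒generated-adj a in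
        no-P₅ (↑ here ab) (↑ (step ab here) bc) (↑ (step ab (step bc here)) cd)
              (↑ (step ab (step bc (step cd here))) de)
    }

Reach-trans : {L : FinSet → Set ℓ} → Reach L a b → Reach L b c → Reach L a c
Reach-trans here b⇝c = b⇝c
Reach-trans (step ab a⇝b) b⇝c = step ab (Reach-trans a⇝b b⇝c)

module _ {L : FinSet → Set ℓ} (respects : ∀ {A B} → A ≋ B → L A → L B) where

  Reach-sym : Reach L a b → Reach L b a
  Reach-sym here = here
  Reach-sym (step ab b⇝c) = Reach-trans (Reach-sym b⇝c) (step (adj-sym respects ab) here)

  -- Cycles of length ≥ 5 and paths on ≥ 5 vertices contain a P₅.
  avoids⇒tree-of-diameter≤3 : AvoidsC₃C₄P₅ L → ∀ v → ComponentIsTree L v × ComponentDiameter≤3 L v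
  avoids⇒tree-of-diameter≤3 avoids v = ((λ _ _ v⇝a v⇝b → Reach-trans (Reach-sym v⇝a) v⇝b) , acyclic) , short
    where
    open AvoidsC₃C₄P₅ avoids

    acyclic : ∀ xs → All (Reach L v) xs → ¬ IsCycle L xs
    acyclic _ _ (_ , [] , refl , s≤s () , _)
    acyclic _ _ (_ , _ ∷ [] , refl , s≤s (s≤s ()) , _)
    acyclic _ _ (_ , _ ∷ _ ∷ [] , refl , _ , _ , ab ∷ bc ∷ ca ∷ [-]) = no-C₃ ab bc ca
    acyclic _ _ (_ , _ ∷ _ ∷ _ ∷ [] , refl , _ , ((_ ∷ a≢c ∷ _) ∷ (_ ∷ b≢d ∷ _) ∷ _) , ab ∷ bc ∷ cd ∷ da ∷ [-]) =
      no-C₄ ab bc cd da a≢c b≢d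
    acyclic _ _ (_ , _ ∷ _ ∷ _ ∷ _ ∷ _ , refl , _ ,
      ((_ ∷ a≢c ∷ a≢d ∷ a≢e ∷ _) ∷ (_ ∷ b≢d ∷ b≢e ∷ _) ∷ (_ ∷ c≢e ∷ _) ∷ _) , ab ∷ bc ∷ cd ∷ de ∷ _) =
      no-P₅ ab bc cd de a≢c a≢d a≢e b≢d b≢e c≢e

    short : ∀ xs → All (Reach L v) xs → IsPath L xs → length xs ≤ 4
    short [] _ _ = z≤n
    short (_ ∷ []) _ _ = s≤s z≤n
    short (_ ∷ _ ∷ []) _ _ = s≤s (s≤s z≤n)
    short (_ ∷ _ ∷ _ ∷ []) _ _ = s≤s (s≤s (s≤s z≤n))
    short (_ ∷ _ ∷ _ ∷ _ ∷ []) _ _ = s≤s (s≤s (s≤s (s≤s z≤n)))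
    short (_ ∷ _ ∷ _ ∷ _ ∷ _ ∷ _) _
      (((_ ∷ a≢c ∷ a≢d ∷ a≢e ∷ _) ∷ (_ ∷ b≢d ∷ b≢e ∷ _) ∷ (_ ∷ c≢e ∷ _) ∷ _) , ab ∷ bc ∷ cd ∷ de ∷ _) =
      ⊥-elim (no-P₅ ab bc cd de a≢c a≢d a≢e b≢d b≢e c≢e)

trees-of-diameter≤3⇒avoids : {L : FinSet → Set ℓ} →
  (∀ v → ComponentIsTree L v × ComponentDiameter≤3 L v) → AvoidsC₃C₄P₅ L
trees-of-diameter≤3⇒avoids trees = record
  { no-C₃ = λ {a} {b} {c} ab bc ca →
      proj₂ (proj₁ (trees a)) (a ∷ b ∷ c ∷ [])
        (here ∷ step ab here ∷ step ab (step bc here) ∷ [])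
        (a , b ∷ c ∷ [] , refl , s≤s (s≤s (s≤s z≤n)) ,
         ((proj₁ ab ∷ ≢-sym (proj₁ ca) ∷ []) ∷ (proj₁ bc ∷ []) ∷ [] ∷ []) , ab ∷ bc ∷ ca ∷ [-])
  ; no-C₄ = λ {a} {b} {c} {d} ab bc cd da a≢c b≢d →
      proj₂ (proj₁ (trees a)) (a ∷ b ∷ c ∷ d ∷ [])
        (here ∷ step ab here ∷ step ab (step bc here) ∷ step ab (step bc (step cd here)) ∷ [])
        (a , b ∷ c ∷ d ∷ [] , refl , s≤s (s≤s (s≤s z≤n)) ,
         ((proj₁ ab ∷ a≢c ∷ ≢-sym (proj₁ da) ∷ []) ∷ (proj₁ bc ∷ b≢d ∷ []) ∷ (proj₁ cd ∷ []) ∷ [] ∷ []) ,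
         ab ∷ bc ∷ cd ∷ da ∷ [-])
  ; no-P₅ = λ {a} {b} {c} {d} {e} ab bc cd de a≢c a≢d a≢e b≢d b≢e c≢e →
      n≮n 4 (proj₂ (trees a) (a ∷ b ∷ c ∷ d ∷ e ∷ [])
        (here ∷ step ab here ∷ step ab (step bc here) ∷ step ab (step bc (step cd here)) ∷
         step ab (step bc (step cd (step de here))) ∷ [])
        (((proj₁ ab ∷ a≢c ∷ a≢d ∷ a≢e ∷ []) ∷ (proj₁ bc ∷ b≢d ∷ b≢e ∷ []) ∷ (proj₁ cd ∷ c≢e ∷ []) ∷
          (proj₁ de ∷ []) ∷ [] ∷ []) ,
         ab ∷ bc ∷ cd ∷ de ∷ [-]))
  }

theorem4p6 : (S : FinSet → Set) → IsBooleanSublattice S → Factorizable S → QuarksOfSize≤2 S →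
    ((UFS S → ∀ (v : ℕ) → UFS (Generated (EdgesOf S v)))
    × ((∀ (v : ℕ) → UFS (Generated (EdgesOf S v))) → UFS S)
    × (UFS S → ∀ (v : ℕ) → ComponentIsTree S v × ComponentDiameter≤3 S v)
    × ((∀ (v : ℕ) → ComponentIsTree S v × ComponentDiameter≤3 S v) → UFS S))
theorem4p6 S bsl factorizable qs =
  (λ ufs v → component-ufs-if-avoids v (avoids⇒component-avoids S bsl (ufs⇒avoids bsl ufs) v)) ,
  (λ components-ufs → ufs-if-avoids (components-avoid⇒avoids S bsl λ v →
     ufs⇒avoids generated-isBooleanSublattice (components-ufs v))) ,
  (λ ufs → avoids⇒tree-of-diameter≤3 respects (ufs⇒avoids bsl ufs)) ,
  (λ trees → ufs-if-avoids (trees-of-diameter≤3⇒avoids trees))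
  where
  open IsBooleanSublattice bsl using (respects)
  open Component S bsl

  ufs-if-avoids : AvoidsC₃C₄P₅ S → UFS S
  ufs-if-avoids = avoids⇒ufs bsl factorizable qs

  component-ufs-if-avoids : ∀ v → AvoidsC₃C₄P₅ (⟨C⟩ v) → UFS (⟨C⟩ v)
  component-ufs-if-avoids v = avoids⇒ufs generated-isBooleanSublattice (generated-factorizable v) (generated-quarks≤2 v)
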